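{- Let $T$ be a hemi-Nelson algebra and let $\theta$ be the relation on $T$ given by $x\,\theta\,y$ iff $x\rightarrow y=1$ and $y\rightarrow x=1$. Then the quotient $T/\theta$, with operations $x/\theta\wedge y/\theta=(x\wedge y)/\theta$, $x/\theta\vee y/\theta=(x\vee y)/\theta$, $x/\theta\rightarrow y/\theta=(x\rightarrow y)/\theta$ and constants $0/\theta$, $1/\theta$, is an h-lattice.
   Context: A Kleene algebra is a bounded distributive lattice $\langle T,\wedge,\vee,0,1\rangle$ with a unary operation $\sim$ such that $\sim\sim x=x$, $\sim(x\wedge y)=\sim x\vee\sim y$ and $(x\wedge\sim x)\wedge(y\vee\sim y)=x\wedge\sim x$. A hemi-Nelson algebra is an algebra $\langle T,\wedge,\vee,\rightarrow,\sim,0,1\rangle$ of type $(2,2,2,1,0,0)$ such that $\langle T,\wedge,\vee,\sim,0,1\rangle$ is a Kleene algebra and for all $x,y,z\in T$: (hN1) $x\rightarrow x=1$; (hN2) $x\wedge(x\rightarrow y)\le x\wedge(\sim x\vee y)$; (hN3) $\sim(x\rightarrow y)\rightarrow(x\wedge\sim y)=1$; (hN4) $(x\wedge\sim y)\rightarrow\sim(x\rightarrow y)=1$; (hN5) $(x\wedge y\wedge(x\rightarrow y))\rightarrow(x\wedge(x\rightarrow y))=1$; (hN6) $(x\wedge(x\rightarrow y))\rightarrow(x\wedge y\wedge(x\rightarrow y))=1$; (hN7) if $x\rightarrow y=1$, $y\rightarrow x=1$, $y\rightarrow z=1$ and $z\rightarrow y=1$ then $x\rightarrow z=1$ and $z\rightarrow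 x=1$; (hN8) if $x\rightarrow y=1$ and $y\rightarrow x=1$ then $(x\wedge z)\rightarrow(y\wedge z)=1$; (hN9) if $x\rightarrow y=1$ and $y\rightarrow x=1$ then $(x\vee z)\rightarrow(y\vee z)=1$; (hN10) if $x\rightarrow y=1$ and $y\rightarrow x=1$ then $(x\rightarrow z)\rightarrow(y\rightarrow z)=1$ and $(z\rightarrow x)\rightarrow(z\rightarrow y)=1$. The relation $\theta$ is an equivalence relation compatible with $\wedge,\vee,\rightarrow$, so the quotient operations are well defined. An h-lattice is an algebra $\langle A,\wedge,\vee,\rightarrow,0,1\rangle$ of type $(2,2,2,0,0)$ such that $\langle A,\wedge,\vee,0,1\rangle$ is a bounded distributive lattice, $a\rightarrow a=1$ and $a\wedge(a\rightarrow b)\le b$ for all $a,b$. -}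

module Defs where

open import Level using (Level; suc; _⊔_)
open import Relation.Binary.Core using (Rel)
open import Relation.Binary.PropositionalEquality using (_≡_)
open import Algebra.Core using (Op₁; Op₂)
open import Algebra.Definitions using (Congruent₂)
open import Algebra.Lattice.Structures using (IsDistributiveLattice)
open import Data.Product using (_×_)

-- Hemi-Nelson algebra (equality is propositional equality on the carrier).
-- Lattice order: x ≤ y  iff  x ∧ y ≡ x.
record HemiNelson (c : Level) : Set (suc c) where
  infixr 7 _∧_
  infixr 6 _∨_
  infixr 5 _⇒_
  field
    Carrier : Set c
    _∧_ _∨_ _⇒_ : Op₂ Carrier
    ∼ : Op₁ Carrier
    𝟘 𝟙 : Carrier
    isDistributiveLattice : IsDistributiveLattice _≡_ _∨_ _∧_
    ∧-zero : ∀ x → x ∧ 𝟘 ≡ 𝟘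
    ∨-one  : ∀ x → x ∨ 𝟙 ≡ 𝟙
    ∼-invol : ∀ x → ∼ (∼ x) ≡ x
    ∼-deMorgan : ∀ x y → ∼ (x ∧ y) ≡ ∼ x ∨ ∼ y
    kleene : ∀ x y → (x ∧ ∼ x) ∧ (y ∨ ∼ y) ≡ x ∧ ∼ x
    hN1 : ∀ x → x ⇒ x ≡ 𝟙
    hN2 : ∀ x y → (x ∧ (x ⇒ y)) ∧ (x ∧ (∼ x ∨ y)) ≡ x ∧ (x ⇒ y)
    hN3 : ∀ x y → ∼ (x ⇒ y) ⇒ (x ∧ ∼ y) ≡ 𝟙
    hN4 : ∀ x y → (x ∧ ∼ y) ⇒ ∼ (x ⇒ y) ≡ 𝟙
    hN5 : ∀ x y → (x ∧ y ∧ (x ⇒ y)) ⇒ (x ∧ (x ⇒ y)) ≡ 𝟙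
    hN6 : ∀ x y → (x ∧ (x ⇒ y)) ⇒ (x ∧ y ∧ (x ⇒ y)) ≡ 𝟙
    hN7 : ∀ x y z → x ⇒ y ≡ 𝟙 → y ⇒ x ≡ 𝟙 → y ⇒ z ≡ 𝟙 → z ⇒ y ≡ 𝟙 →
          (x ⇒ z ≡ 𝟙) × (z ⇒ x ≡ 𝟙)
    hN8 : ∀ x y z → x ⇒ y ≡ 𝟙 → y ⇒ x ≡ 𝟙 → (x ∧ z) ⇒ (y ∧ z) ≡ 𝟙
    hN9 : ∀ x y z → x ⇒ y ≡ 𝟙 → y ⇒ x ≡ 𝟙 → (x ∨ z) ⇒ (y ∨ z) ≡ 𝟙
    hN10 : ∀ x y z → x ⇒ y ≡ 𝟙 → y ⇒ x ≡ 𝟙 →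
           ((x ⇒ z) ⇒ (y ⇒ z) ≡ 𝟙) × ((z ⇒ x) ⇒ (z ⇒ y) ≡ 𝟙)

  θ : Rel Carrier c
  θ x y = (x ⇒ y ≡ 𝟙) × (y ⇒ x ≡ 𝟙)

-- An h-lattice presented on a carrier A modulo an equivalence _≈_
-- (i.e. the quotient A/≈ with the induced operations is an h-lattice).
-- IsDistributiveLattice includes that _≈_ is an equivalence and that
-- ∧, ∨ are congruences; we additionally require ⇒ to be a congruence,
-- so the operations on A/≈ are well defined.
-- Order modulo ≈:  a ≤ b  iff  a ∧ b ≈ a.
record IsHLattice {a ℓ} {A : Set a} (_≈_ : Rel A ℓ)
                  (_∧_ _∨_ _⇒_ : Op₂ A) (𝟘 𝟙 : A) : Set (a ⊔ ℓ) where
  field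
    isDistributiveLattice : IsDistributiveLattice _≈_ _∨_ _∧_
    ⇒-cong : Congruent₂ _≈_ _⇒_
    ∧-zero : ∀ x → (x ∧ 𝟘) ≈ 𝟘
    ∨-one  : ∀ x → (x ∨ 𝟙) ≈ 𝟙
    ⇒-refl : ∀ x → (x ⇒ x) ≈ 𝟙
    mp : ∀ x y → ((x ∧ (x ⇒ y)) ∧ y) ≈ (x ∧ (x ⇒ y))

{-# OPTIONS --safe #-}
module Submission where

-- θ is an equivalence by hN1 and hN7, and hN8–hN10 make it a congruence
-- (hN8 and hN9 only on one side, which commutativity of ∧ and ∨ completes),
-- so every lattice identity of T holds in T/θ. Modus ponens holds in T/θ
-- because hN5 and hN6 say exactly that x ∧ (x ⇒ y) θ x ∧ y ∧ (x ⇒ y).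

open import Defs
open import Algebra.Core using (Op₂)
open import Algebra.Definitions using (Commutative; Congruent₂; RightCongruent)
open import Algebra.Lattice.Structures using (IsDistributiveLattice)
open import Data.Product using (_,_; proj₁; proj₂; map)
open import Relation.Binary.Consequences using (monoˡ∧monoʳ⇒mono₂)
open import Relation.Binary.Core using (Rel)
open import Relation.Binary.Definitions using (LeftMonotonic; RightMonotonic)
open import Relation.Binary.PropositionalEquality using (_≡_; refl; cong; module ≡-Reasoning)
open import Relation.Binary.Structures using (IsEquivalence)

module _ {a ℓ} {A : Set a} {_≈_ : Rel A ℓ} (≈-isEquivalence : IsEquivalence _≈_) where
  open IsEquivalence ≈-isEquivalence

  comm∧congʳ⇒cong : ∀ {_∙_ : Op₂ A} →
    Commutative _≈_ _∙_ → RightCongruent _≈_ _∙_ → Congruent₂ _≈_ _∙_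
  comm∧congʳ⇒cong comm congʳ {x} {y} {u} {v} x≈y u≈v =
    trans (congʳ x≈y) (trans (comm y u) (trans (congʳ u≈v) (comm v y)))

  isDistributiveLattice-coarsen : ∀ {_∨_ _∧_ : Op₂ A} →
    Congruent₂ _≈_ _∨_ → Congruent₂ _≈_ _∧_ →
    IsDistributiveLattice _≡_ _∨_ _∧_ → IsDistributiveLattice _≈_ _∨_ _∧_
  isDistributiveLattice-coarsen ∨-cong ∧-cong L = record
    { isLattice = record
      { isEquivalence = ≈-isEquivalence
      ; ∨-comm = λ x y → reflexive (∨-comm x y)
      ; ∨-assoc = λ x y z → reflexive (∨-assoc x y z)
      ; ∨-cong = ∨-cong
      ; ∧-comm = λ x y → reflexive (∧-comm x y)
      ; ∧-assoc = λ x y z → reflexive (∧-assoc x y z)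
      ; ∧-cong = ∧-cong
      ; absorptive = map (λ law x y → reflexive (law x y))
                         (λ law x y → reflexive (law x y)) absorptive
      }
    ; ∨-distrib-∧ = map (λ law x y z → reflexive (law x y z))
                      (λ law x y z → reflexive (law x y z)) ∨-distrib-∧
    ; ∧-distrib-∨ = map (λ law x y z → reflexive (law x y z))
                      (λ law x y z → reflexive (law x y z)) ∧-distrib-∨
    }
    where
    open IsDistributiveLattice L
      using (∨-comm; ∨-assoc; ∧-comm; ∧-assoc; absorptive; ∨-distrib-∧; ∧-distrib-∨)

module HemiNelsonQuotient {c} (T : HemiNelson c) where
  open HemiNelson T
  private module L = IsDistributiveLattice isDistributiveLattice

  θ-reflexive : ∀ {x y} → x ≡ y → θ x y
  θ-reflexive {x} refl = hN1 x , hN1 x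

  θ-isEquivalence : IsEquivalence θ
  θ-isEquivalence = record
    { refl = θ-reflexive refl
    ; sym = λ (p , q) → q , p
    ; trans = λ {x} {y} {z} (p , q) (r , s) → hN7 x y z p q r s
    }

  open IsEquivalence θ-isEquivalence using () renaming (trans to θ-trans)

  ∧-congʳ : RightCongruent θ _∧_
  ∧-congʳ {z} {x} {y} (p , q) = hN8 x y z p q , hN8 y x z q p

  ∨-congʳ : RightCongruent θ _∨_
  ∨-congʳ {z} {x} {y} (p , q) = hN9 x y z p q , hN9 y x z q p

  ∧-cong : Congruent₂ θ _∧_
  ∧-cong = comm∧congʳ⇒cong θ-isEquivalence (λ x y → θ-reflexive (L.∧-comm x y)) ∧-congʳ

  ∨-cong : Congruent₂ θ _∨_
  ∨-cong = comm∧congʳ⇒cong θ-isEquivalence (λ x y → θ-reflexive (L.∨-comm x y)) ∨-congʳ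

  ⇒-congˡ : LeftMonotonic θ θ _⇒_
  ⇒-congˡ z {x} {y} (p , q) = proj₂ (hN10 x y z p q) , proj₂ (hN10 y x z q p)

  ⇒-congʳ : RightMonotonic θ θ _⇒_
  ⇒-congʳ z {x} {y} (p , q) = proj₁ (hN10 x y z p q) , proj₁ (hN10 y x z q p)

  ⇒-cong : Congruent₂ θ _⇒_
  ⇒-cong = monoˡ∧monoʳ⇒mono₂ θ θ θ θ-trans ⇒-congˡ ⇒-congʳ

  mp : ∀ x y → θ ((x ∧ (x ⇒ y)) ∧ y) (x ∧ (x ⇒ y))
  mp x y = θ-trans (θ-reflexive rearrange) (hN5 x y , hN6 x y)
    where
    rearrange : (x ∧ (x ⇒ y)) ∧ y ≡ x ∧ y ∧ (x ⇒ y)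
    rearrange = begin
      (x ∧ (x ⇒ y)) ∧ y ≡⟨ L.∧-assoc x (x ⇒ y) y ⟩
      x ∧ ((x ⇒ y) ∧ y) ≡⟨ cong (x ∧_) (L.∧-comm (x ⇒ y) y) ⟩
      x ∧ y ∧ (x ⇒ y)   ∎
      where open ≡-Reasoning

proposition10 : ∀ {c} (T : HemiNelson c) →
    let open HemiNelson T in IsHLattice θ _∧_ _∨_ _⇒_ 𝟘 𝟙
proposition10 T = record
  { isDistributiveLattice =
      isDistributiveLattice-coarsen θ-isEquivalence ∨-cong ∧-cong isDistributiveLattice
  ; ⇒-cong = ⇒-cong
  ; ∧-zero = λ x → θ-reflexive (∧-zero x)
  ; ∨-one = λ x → θ-reflexive (∨-one x)
  ; ⇒-refl = λ x → θ-reflexive (hN1 x)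
  ; mp = mp
  }
  where
  open HemiNelson T
  open HemiNelsonQuotient T
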